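{- For every nonzero $v=9\ell+8\ell'$ with $\ell,\ell'\in\{0,1,2,\dots\}$, there exists a $3$-way $3$-homogeneous $(v,3,2)$ Steiner trade of volume $v$.
   Context: Let $V$ be a finite set with $v$ elements and let $t<k<v$ be positive integers. A $\mu$-way $(v,k,t)$ trade $T=\{T_1,\dots,T_\mu\}$ of volume $m$ consists of $\mu$ pairwise disjoint collections $T_1,\dots,T_\mu$, each of $m$ blocks ($k$-subsets of $V$), such that every $t$-subset of $V$ is contained in the same number of blocks in each $T_i$. The foundation $\mathrm{found}(T)$ is the set of elements covered by the blocks. It is a Steiner trade if every $t$-subset of $\mathrm{found}(T)$ is in at most one block of each $T_i$, and $d$-homogeneous if every element of $V$ lies in exactly $d$ blocks of each $T_i$. -}

module Defs where

open import Data.Nat using (ℕ; _≤_)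
open import Data.Fin using (Fin; _<_; _≟_)
open import Data.Vec using (Vec; lookup; count)
open import Data.Product using (Σ; ∃; _×_; _,_)
open import Data.Sum using (_⊎_)
open import Relation.Binary.PropositionalEquality using (_≡_; _≢_)
open import Relation.Nullary using (¬_)
open import Relation.Nullary.Decidable using (Dec; _⊎-dec_; _×-dec_)

-- A block (k-subset with k = 3) of V = Fin v, listed in increasing order.
record Block (v : ℕ) : Set where
  constructor blk
  field
    a b c : Fin v
    a<b : a < b
    b<c : b < c
open Block public

_∈B_ : ∀ {v} → Fin v → Block v → Set
x ∈B B = x ≡ a B ⊎ x ≡ b B ⊎ x ≡ c B

_∈B?_ : ∀ {v} (x : Fin v) (B : Block v) → Dec (x ∈B B)
x ∈B? B = (x ≟ a B) ⊎-dec ((x ≟ b B) ⊎-dec (x ≟ c B))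

SameBlock : ∀ {v} → Block v → Block v → Set
SameBlock B C = a B ≡ a C × b B ≡ b C × c B ≡ c C

Collection : ℕ → ℕ → Set
Collection v m = Vec (Block v) m

NoRepeats : ∀ {v m} → Collection v m → Set
NoRepeats {v} {m} T = (j j' : Fin m) → j ≢ j' → ¬ SameBlock (lookup T j) (lookup T j')

deg : ∀ {v m} → Fin v → Collection v m → ℕ
deg x T = count (λ B → x ∈B? B) T

pairDeg : ∀ {v m} → Fin v → Fin v → Collection v m → ℕ
pairDeg x y T = count (λ B → (x ∈B? B) ×-dec (y ∈B? B)) T

IsTrade : ∀ {v m μ} → (Fin μ → Collection v m) → Set
IsTrade {v} {m} {μ} T =
  ((i : Fin μ) → NoRepeats (T i))
  × ((i i' : Fin μ) → i ≢ i' → (j j' : Fin m) →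
       ¬ SameBlock (lookup (T i) j) (lookup (T i') j'))
  × ((x y : Fin v) → x ≢ y → (i i' : Fin μ) →
       pairDeg x y (T i) ≡ pairDeg x y (T i'))

InFound : ∀ {v m μ} → (Fin μ → Collection v m) → Fin v → Set
InFound {v} {m} {μ} T x = Σ (Fin μ) λ i → Σ (Fin m) λ j → x ∈B lookup (T i) j

IsSteinerTrade : ∀ {v m μ} → (Fin μ → Collection v m) → Set
IsSteinerTrade {v} {m} {μ} T =
  IsTrade T
  × ((x y : Fin v) → x ≢ y → InFound T x → InFound T y → (i : Fin μ) →
       pairDeg x y (T i) ≤ 1)

IsHomogeneous : ∀ {v m μ} → ℕ → (Fin μ → Collection v m) → Set
IsHomogeneous {v} {m} {μ} d T = (x : Fin v) (i : Fin μ) → deg x (T i) ≡ d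

-- The proof is by disjoint union.  If T is a μ-way d-homogeneous Steiner trade
-- on v points and U one on w points, then placing T on the first v points of
-- Fin (v + w) and U on the last w points, and taking T i ++ U i as the i-th
-- collection, gives a μ-way d-homogeneous Steiner trade on v + w points: a
-- point or pair inside one half sees exactly the blocks of that half, and a
-- pair straddling the two halves lies in no block at all.
--
-- The two base trades, on 8 and on 9 points, are listed explicitly and their
-- properties are decided by computation.  The theorem is the union of ℓ copies
-- of the 9-point trade with ℓ' copies of the 8-point trade.
module Submission where

open import Defs
open import Data.Nat using (ℕ; zero; suc; _+_; _*_; _≤_; z≤n)
import Data.Nat as ℕ
open import Data.Nat.Properties using (+-identityʳ; m≤m+n; <⇒≱; +-monoʳ-<)
import Data.Nat.Properties as ℕ
open import Data.Fin using (Fin; toℕ; _↑ˡ_; _↑ʳ_; #_; _<_)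
import Data.Fin as Fin
open import Data.Fin.Properties
  using (toℕ-↑ˡ; toℕ-↑ʳ; ↑ˡ-injective; ↑ʳ-injective; toℕ<n; all?; _<?_)
open import Data.Vec using (Vec; []; _∷_; _++_; map; lookup; count)
open import Data.Vec.Properties using (lookup-++ˡ; lookup-++ʳ; lookup-map)
open import Data.Product using (Σ; _×_; _,_; proj₁; proj₂)
open import Data.Sum using (_⊎_; inj₁; inj₂; [_,_]) renaming (map to ⊎-map)
open import Data.Empty using (⊥-elim)
open import Data.Bool using (true; false)
open import Relation.Binary.PropositionalEquality
  using (_≡_; _≢_; refl; sym; trans; cong; cong₂; subst; subst₂)
open Relation.Binary.PropositionalEquality.≡-Reasoning
open import Relation.Nullary using (¬_; Dec; yes; no; does; ¬?)
open import Relation.Nullary.Decidable using (True; toWitness; _⊎-dec_; _×-dec_)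
open import Relation.Unary using (Pred; Decidable)
open import Level using (0ℓ)

count-++ : {A : Set} {P : Pred A 0ℓ} (P? : Decidable P) {p q : ℕ}
           (xs : Vec A p) (ys : Vec A q) →
           count P? (xs ++ ys) ≡ count P? xs + count P? ys
count-++ P? [] ys = refl
count-++ P? (x ∷ xs) ys with does (P? x)
... | true = cong suc (count-++ P? xs ys)
... | false = count-++ P? xs ys

module _ {A B : Set} {P : Pred B 0ℓ} (P? : Decidable P) (f : A → B) where

  count-map : {Q : Pred A 0ℓ} (Q? : Decidable Q) →
              (∀ x → P (f x) → Q x) → (∀ x → Q x → P (f x)) →
              {p : ℕ} (xs : Vec A p) → count P? (map f xs) ≡ count Q? xs
  count-map Q? to from [] = refl
  count-map Q? to from (x ∷ xs) with P? (f x) | Q? x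
  ... | yes _ | yes _ = cong suc (count-map Q? to from xs)
  ... | no _ | no _ = count-map Q? to from xs
  ... | yes p | no ¬q = ⊥-elim (¬q (to x p))
  ... | no ¬p | yes q = ⊥-elim (¬p (from x q))

  count-map-none : (∀ x → ¬ P (f x)) → {p : ℕ} (xs : Vec A p) →
                   count P? (map f xs) ≡ 0
  count-map-none none [] = refl
  count-map-none none (x ∷ xs) with P? (f x)
  ... | yes p = ⊥-elim (none x p)
  ... | no _ = count-map-none none xs

-- Relabelling blocks along an order embedding Fin m → Fin v.  Strict
-- monotonicity keeps the points of a block in increasing order.

record OrderEmbedding (m v : ℕ) : Set where
  field
    embed : Fin m → Fin v
    monotone : {x y : Fin m} → x < y → embed x < embed y
    injective : {x y : Fin m} → embed x ≡ embed y → x ≡ y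

module Relabel {m v : ℕ} (e : OrderEmbedding m v) where
  open OrderEmbedding e

  relabel : Block m → Block v
  relabel B = blk (embed (a B)) (embed (b B)) (embed (c B))
                  (monotone (a<b B)) (monotone (b<c B))

  Outside : Fin v → Set
  Outside y = (x : Fin m) → embed x ≢ y

  ∈-relabel⁺ : {x : Fin m} (B : Block m) → x ∈B B → embed x ∈B relabel B
  ∈-relabel⁺ B = ⊎-map (cong embed) (⊎-map (cong embed) (cong embed))

  ∈-relabel⁻ : {x : Fin m} (B : Block m) → embed x ∈B relabel B → x ∈B B
  ∈-relabel⁻ B = ⊎-map injective (⊎-map injective injective)

  ∉-relabel : {y : Fin v} → Outside y → (B : Block m) → ¬ y ∈B relabel B
  ∉-relabel out B =
    [ (λ eq → out (a B) (sym eq)) ,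
    [ (λ eq → out (b B) (sym eq)) , (λ eq → out (c B) (sym eq)) ] ]

  relabel-sameBlock : (B B' : Block m) → SameBlock (relabel B) (relabel B') →
                      SameBlock B B'
  relabel-sameBlock B B' (eq₁ , eq₂ , eq₃) = injective eq₁ , injective eq₂ , injective eq₃

  deg-relabel : (x : Fin m) {p : ℕ} (T : Collection m p) →
                deg (embed x) (map relabel T) ≡ deg x T
  deg-relabel x = count-map (embed x ∈B?_) relabel (x ∈B?_) ∈-relabel⁻ ∈-relabel⁺

  deg-outside : {y : Fin v} → Outside y → {p : ℕ} (T : Collection m p) →
                deg y (map relabel T) ≡ 0
  deg-outside {y} out = count-map-none (y ∈B?_) relabel (∉-relabel out)

  pairDeg-relabel : (x y : Fin m) {p : ℕ} (T : Collection m p) →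
                    pairDeg (embed x) (embed y) (map relabel T) ≡ pairDeg x y T
  pairDeg-relabel x y =
    count-map (λ B → (embed x ∈B? B) ×-dec (embed y ∈B? B)) relabel
              (λ B → (x ∈B? B) ×-dec (y ∈B? B))
              (λ B (p , q) → ∈-relabel⁻ B p , ∈-relabel⁻ B q)
              (λ B (p , q) → ∈-relabel⁺ B p , ∈-relabel⁺ B q)

  pairDeg-outsideˡ : {x : Fin v} → Outside x → (y : Fin v) {p : ℕ} (T : Collection m p) →
                     pairDeg x y (map relabel T) ≡ 0
  pairDeg-outsideˡ {x} out y =
    count-map-none (λ B → (x ∈B? B) ×-dec (y ∈B? B)) relabel
                   (λ B (p , _) → ∉-relabel out B p)

  pairDeg-outsideʳ : (x : Fin v) {y : Fin v} → Outside y → {p : ℕ} (T : Collection m p) →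
                     pairDeg x y (map relabel T) ≡ 0
  pairDeg-outsideʳ x {y} out =
    count-map-none (λ B → (x ∈B? B) ×-dec (y ∈B? B)) relabel
                   (λ B (_ , q) → ∉-relabel out B q)

↑ˡ≢↑ʳ : {v w : ℕ} (x : Fin v) (y : Fin w) → x ↑ˡ w ≢ v ↑ʳ y
↑ˡ≢↑ʳ {v} {w} x y eq = <⇒≱ (toℕ<n x) (subst (v ≤_) (sym toℕ-eq) (m≤m+n v (toℕ y)))
  where
  toℕ-eq : toℕ x ≡ v + toℕ y
  toℕ-eq = trans (sym (toℕ-↑ˡ x w)) (trans (cong toℕ eq) (toℕ-↑ʳ v y))

data Side (v w : ℕ) : Fin (v + w) → Set where
  left : (x : Fin v) → Side v w (x ↑ˡ w)
  right : (y : Fin w) → Side v w (v ↑ʳ y)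

side : (v w : ℕ) (z : Fin (v + w)) → Side v w z
side zero w z = right z
side (suc v) w Fin.zero = left Fin.zero
side (suc v) w (Fin.suc z) with side v w z
... | left x = left (Fin.suc x)
... | right y = right y

↑ˡ-embedding : (v w : ℕ) → OrderEmbedding v (v + w)
↑ˡ-embedding v w = record
  { embed = _↑ˡ w
  ; monotone = λ {x} {y} x<y → subst₂ ℕ._<_ (sym (toℕ-↑ˡ x w)) (sym (toℕ-↑ˡ y w)) x<y
  ; injective = ↑ˡ-injective w _ _
  }

↑ʳ-embedding : (v w : ℕ) → OrderEmbedding w (v + w)
↑ʳ-embedding v w = record
  { embed = v ↑ʳ_
  ; monotone = λ {x} {y} x<y →
      subst₂ ℕ._<_ (sym (toℕ-↑ʳ v x)) (sym (toℕ-↑ʳ v y)) (+-monoʳ-< v x<y)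
  ; injective = ↑ʳ-injective v _ _
  }

module DisjointUnion {v w : ℕ} where
  module L = Relabel (↑ˡ-embedding v w)
  module R = Relabel (↑ʳ-embedding v w)

  infixr 5 _⊕_
  _⊕_ : {m n : ℕ} → Collection v m → Collection w n → Collection (v + w) (m + n)
  T ⊕ U = map L.relabel T ++ map R.relabel U

  right-outside-L : (y : Fin w) → L.Outside (v ↑ʳ y)
  right-outside-L y x = ↑ˡ≢↑ʳ x y

  left-outside-R : (x : Fin v) → R.Outside (x ↑ˡ w)
  left-outside-R x y eq = ↑ˡ≢↑ʳ x y (sym eq)

  module _ {m n : ℕ} (T : Collection v m) (U : Collection w n) where

    deg-⊕ˡ : (x : Fin v) → deg (x ↑ˡ w) (T ⊕ U) ≡ deg x T
    deg-⊕ˡ x = trans (count-++ ((x ↑ˡ w) ∈B?_) (map L.relabel T) (map R.relabel U))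
      (trans (cong₂ _+_ (L.deg-relabel x T) (R.deg-outside (left-outside-R x) U))
             (+-identityʳ _))

    deg-⊕ʳ : (y : Fin w) → deg (v ↑ʳ y) (T ⊕ U) ≡ deg y U
    deg-⊕ʳ y = trans (count-++ ((v ↑ʳ y) ∈B?_) (map L.relabel T) (map R.relabel U))
      (cong₂ _+_ (L.deg-outside (right-outside-L y) T) (R.deg-relabel y U))

    pairDeg-⊕ : (x y : Fin (v + w)) →
                pairDeg x y (T ⊕ U) ≡
                pairDeg x y (map L.relabel T) + pairDeg x y (map R.relabel U)
    pairDeg-⊕ x y =
      count-++ (λ B → (x ∈B? B) ×-dec (y ∈B? B)) (map L.relabel T) (map R.relabel U)

    pairDeg-⊕ˡ : (x x' : Fin v) → pairDeg (x ↑ˡ w) (x' ↑ˡ w) (T ⊕ U) ≡ pairDeg x x' T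
    pairDeg-⊕ˡ x x' = trans (pairDeg-⊕ _ _)
      (trans (cong₂ _+_ (L.pairDeg-relabel x x' T)
                        (R.pairDeg-outsideˡ (left-outside-R x) (x' ↑ˡ w) U))
             (+-identityʳ _))

    pairDeg-⊕ʳ : (y y' : Fin w) → pairDeg (v ↑ʳ y) (v ↑ʳ y') (T ⊕ U) ≡ pairDeg y y' U
    pairDeg-⊕ʳ y y' = trans (pairDeg-⊕ _ _)
      (cong₂ _+_ (L.pairDeg-outsideˡ (right-outside-L y) (v ↑ʳ y') T)
                 (R.pairDeg-relabel y y' U))

    pairDeg-⊕-lr : (x : Fin v) (y : Fin w) → pairDeg (x ↑ˡ w) (v ↑ʳ y) (T ⊕ U) ≡ 0
    pairDeg-⊕-lr x y = trans (pairDeg-⊕ _ _)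
      (cong₂ _+_ (L.pairDeg-outsideʳ (x ↑ˡ w) (right-outside-L y) T)
                 (R.pairDeg-outsideˡ (left-outside-R x) (v ↑ʳ y) U))

    pairDeg-⊕-rl : (y : Fin w) (x : Fin v) → pairDeg (v ↑ʳ y) (x ↑ˡ w) (T ⊕ U) ≡ 0
    pairDeg-⊕-rl y x = trans (pairDeg-⊕ _ _)
      (cong₂ _+_ (L.pairDeg-outsideˡ (right-outside-L y) (x ↑ˡ w) T)
                 (R.pairDeg-outsideʳ (v ↑ʳ y) (left-outside-R x) U))

  lookup-⊕ˡ : {m n : ℕ} (T : Collection v m) (U : Collection w n) (p : Fin m) →
              lookup (T ⊕ U) (p ↑ˡ n) ≡ L.relabel (lookup T p)
  lookup-⊕ˡ T U p =
    trans (lookup-++ˡ (map L.relabel T) (map R.relabel U) p) (lookup-map p L.relabel T)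

  lookup-⊕ʳ : {m n : ℕ} (T : Collection v m) (U : Collection w n) (q : Fin n) →
              lookup (T ⊕ U) (m ↑ʳ q) ≡ R.relabel (lookup U q)
  lookup-⊕ʳ T U q =
    trans (lookup-++ʳ (map L.relabel T) (map R.relabel U) q) (lookup-map q R.relabel U)

  sameBlock-⊕ : {m n : ℕ} (T T' : Collection v m) (U U' : Collection w n)
                (j j' : Fin (m + n)) →
                SameBlock (lookup (T ⊕ U) j) (lookup (T' ⊕ U') j') →
                Σ (Fin m) (λ p → Σ (Fin m) λ p' →
                  j ≡ p ↑ˡ n × j' ≡ p' ↑ˡ n × SameBlock (lookup T p) (lookup T' p'))
                ⊎ Σ (Fin n) (λ q → Σ (Fin n) λ q' →
                  j ≡ m ↑ʳ q × j' ≡ m ↑ʳ q' × SameBlock (lookup U q) (lookup U' q'))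
  sameBlock-⊕ {m} {n} T T' U U' j j' same with side m n j | side m n j'
  ... | left p | left p' =
    inj₁ (p , p' , refl , refl , L.relabel-sameBlock (lookup T p) (lookup T' p') same')
    where
    same' : SameBlock (L.relabel (lookup T p)) (L.relabel (lookup T' p'))
    same' = subst₂ SameBlock (lookup-⊕ˡ T U p) (lookup-⊕ˡ T' U' p') same
  ... | left p | right q' = ⊥-elim (↑ˡ≢↑ʳ (a (lookup T p)) (a (lookup U' q')) (proj₁ same'))
    where
    same' : SameBlock (L.relabel (lookup T p)) (R.relabel (lookup U' q'))
    same' = subst₂ SameBlock (lookup-⊕ˡ T U p) (lookup-⊕ʳ T' U' q') same
  ... | right q | left p' = ⊥-elim (↑ˡ≢↑ʳ (a (lookup T' p')) (a (lookup U q)) (sym (proj₁ same')))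
    where
    same' : SameBlock (R.relabel (lookup U q)) (L.relabel (lookup T' p'))
    same' = subst₂ SameBlock (lookup-⊕ʳ T U q) (lookup-⊕ˡ T' U' p') same
  ... | right q | right q' =
    inj₂ (q , q' , refl , refl , R.relabel-sameBlock (lookup U q) (lookup U' q') same')
    where
    same' : SameBlock (R.relabel (lookup U q)) (R.relabel (lookup U' q'))
    same' = subst₂ SameBlock (lookup-⊕ʳ T U q) (lookup-⊕ʳ T' U' q') same

open DisjointUnion
  using (_⊕_; deg-⊕ˡ; deg-⊕ʳ; pairDeg-⊕ˡ; pairDeg-⊕ʳ; pairDeg-⊕-lr; pairDeg-⊕-rl; sameBlock-⊕)

-- A μ-way d-homogeneous Steiner trade in the strong form preserved by
-- disjoint unions: equal pair degrees and the Steiner bound are required for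
-- all pairs, not only for distinct pairs of points in the foundation.

record IsHomogeneousSteinerTrade {μ v m : ℕ} (d : ℕ) (T : Fin μ → Collection v m) : Set where
  field
    noRepeats : (i : Fin μ) → NoRepeats (T i)
    disjoint : (i i' : Fin μ) → i ≢ i' → (j j' : Fin m) →
               ¬ SameBlock (lookup (T i) j) (lookup (T i') j')
    balanced : (x y : Fin v) (i i' : Fin μ) → pairDeg x y (T i) ≡ pairDeg x y (T i')
    steiner : (x y : Fin v) → x ≢ y → (i : Fin μ) → pairDeg x y (T i) ≤ 1
    homogeneous : (x : Fin v) (i : Fin μ) → deg x (T i) ≡ d

HomogeneousSteinerTrade : (μ d v m : ℕ) → Set
HomogeneousSteinerTrade μ d v m = Σ (Fin μ → Collection v m) (IsHomogeneousSteinerTrade d)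

steinerTrade : {μ v m d : ℕ} {T : Fin μ → Collection v m} →
               IsHomogeneousSteinerTrade d T → IsSteinerTrade T × IsHomogeneous d T
steinerTrade t =
  ((noRepeats , disjoint , λ x y _ → balanced x y) , λ x y x≢y _ _ → steiner x y x≢y) ,
  homogeneous
  where open IsHomogeneousSteinerTrade t

emptyTrade : (μ d : ℕ) → HomogeneousSteinerTrade μ d 0 0
emptyTrade μ d = (λ _ → []) , record
  { noRepeats = λ _ ()
  ; disjoint = λ _ _ _ ()
  ; balanced = λ ()
  ; steiner = λ ()
  ; homogeneous = λ ()
  }

module _ {μ d v w m n : ℕ} {T : Fin μ → Collection v m} {U : Fin μ → Collection w n}
         (t : IsHomogeneousSteinerTrade d T) (u : IsHomogeneousSteinerTrade d U) where
  private
    module t = IsHomogeneousSteinerTrade t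
    module u = IsHomogeneousSteinerTrade u

  ⊕-isTrade : IsHomogeneousSteinerTrade d (λ i → T i ⊕ U i)
  ⊕-isTrade = record
    { noRepeats = noRepeats
    ; disjoint = disjoint
    ; balanced = balanced
    ; steiner = steiner
    ; homogeneous = homogeneous
    }
    where
    noRepeats : (i : Fin μ) → NoRepeats (T i ⊕ U i)
    noRepeats i j j' j≢j' same with sameBlock-⊕ (T i) (T i) (U i) (U i) j j' same
    ... | inj₁ (p , p' , refl , refl , s) = t.noRepeats i p p' (λ eq → j≢j' (cong (_↑ˡ n) eq)) s
    ... | inj₂ (q , q' , refl , refl , s) = u.noRepeats i q q' (λ eq → j≢j' (cong (m ↑ʳ_) eq)) s

    disjoint : (i i' : Fin μ) → i ≢ i' → (j j' : Fin (m + n)) →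
               ¬ SameBlock (lookup (T i ⊕ U i) j) (lookup (T i' ⊕ U i') j')
    disjoint i i' i≢i' j j' same with sameBlock-⊕ (T i) (T i') (U i) (U i') j j' same
    ... | inj₁ (p , p' , refl , refl , s) = t.disjoint i i' i≢i' p p' s
    ... | inj₂ (q , q' , refl , refl , s) = u.disjoint i i' i≢i' q q' s

    balanced : (x y : Fin (v + w)) (i i' : Fin μ) →
               pairDeg x y (T i ⊕ U i) ≡ pairDeg x y (T i' ⊕ U i')
    balanced z z' i i' with side v w z | side v w z'
    ... | left x | left y = begin
      pairDeg (x ↑ˡ w) (y ↑ˡ w) (T i ⊕ U i)   ≡⟨ pairDeg-⊕ˡ (T i) (U i) x y ⟩
      pairDeg x y (T i)                       ≡⟨ t.balanced x y i i' ⟩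
      pairDeg x y (T i')                      ≡⟨ pairDeg-⊕ˡ (T i') (U i') x y ⟨
      pairDeg (x ↑ˡ w) (y ↑ˡ w) (T i' ⊕ U i') ∎
    ... | left x | right y =
      trans (pairDeg-⊕-lr (T i) (U i) x y) (sym (pairDeg-⊕-lr (T i') (U i') x y))
    ... | right x | left y =
      trans (pairDeg-⊕-rl (T i) (U i) x y) (sym (pairDeg-⊕-rl (T i') (U i') x y))
    ... | right x | right y = begin
      pairDeg (v ↑ʳ x) (v ↑ʳ y) (T i ⊕ U i)   ≡⟨ pairDeg-⊕ʳ (T i) (U i) x y ⟩
      pairDeg x y (U i)                       ≡⟨ u.balanced x y i i' ⟩
      pairDeg x y (U i')                      ≡⟨ pairDeg-⊕ʳ (T i') (U i') x y ⟨
      pairDeg (v ↑ʳ x) (v ↑ʳ y) (T i' ⊕ U i') ∎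

    steiner : (x y : Fin (v + w)) → x ≢ y → (i : Fin μ) → pairDeg x y (T i ⊕ U i) ≤ 1
    steiner z z' z≢z' i with side v w z | side v w z'
    ... | left x | left y = subst (_≤ 1) (sym (pairDeg-⊕ˡ (T i) (U i) x y))
                                  (t.steiner x y (λ eq → z≢z' (cong (_↑ˡ w) eq)) i)
    ... | left x | right y = subst (_≤ 1) (sym (pairDeg-⊕-lr (T i) (U i) x y)) z≤n
    ... | right x | left y = subst (_≤ 1) (sym (pairDeg-⊕-rl (T i) (U i) x y)) z≤n
    ... | right x | right y = subst (_≤ 1) (sym (pairDeg-⊕ʳ (T i) (U i) x y))
                                    (u.steiner x y (λ eq → z≢z' (cong (v ↑ʳ_) eq)) i)

    homogeneous : (x : Fin (v + w)) (i : Fin μ) → deg x (T i ⊕ U i) ≡ d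
    homogeneous z i with side v w z
    ... | left x = trans (deg-⊕ˡ (T i) (U i) x) (t.homogeneous x i)
    ... | right x = trans (deg-⊕ʳ (T i) (U i) x) (u.homogeneous x i)

_⊕ₜ_ : {μ d v w m n : ℕ} → HomogeneousSteinerTrade μ d v m → HomogeneousSteinerTrade μ d w n →
       HomogeneousSteinerTrade μ d (v + w) (m + n)
(T , t) ⊕ₜ (U , u) = (λ i → T i ⊕ U i) , ⊕-isTrade t u

copies : {μ d v m : ℕ} → HomogeneousSteinerTrade μ d v m → (ℓ : ℕ) →
         HomogeneousSteinerTrade μ d (ℓ * v) (ℓ * m)
copies {μ} {d} t zero = emptyTrade μ d
copies t (suc ℓ) = t ⊕ₜ copies t ℓ

sameBlock? : {v : ℕ} (B B' : Block v) → Dec (SameBlock B B')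
sameBlock? B B' = (a B Fin.≟ a B') ×-dec ((b B Fin.≟ b B') ×-dec (c B Fin.≟ c B'))

module Decide {μ v m : ℕ} (d : ℕ) (T : Fin μ → Collection v m) where

  noRepeats? : Dec ((i : Fin μ) (j j' : Fin m) →
                    j ≡ j' ⊎ ¬ SameBlock (lookup (T i) j) (lookup (T i) j'))
  noRepeats? = all? λ i → all? λ j → all? λ j' →
    (j Fin.≟ j') ⊎-dec ¬? (sameBlock? (lookup (T i) j) (lookup (T i) j'))

  disjoint? : Dec ((i i' : Fin μ) (j j' : Fin m) →
                   i ≡ i' ⊎ ¬ SameBlock (lookup (T i) j) (lookup (T i') j'))
  disjoint? = all? λ i → all? λ i' → all? λ j → all? λ j' →
    (i Fin.≟ i') ⊎-dec ¬? (sameBlock? (lookup (T i) j) (lookup (T i') j'))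

  balanced? : Dec ((x y : Fin v) (i i' : Fin μ) → pairDeg x y (T i) ≡ pairDeg x y (T i'))
  balanced? = all? λ x → all? λ y → all? λ i → all? λ i' →
    pairDeg x y (T i) ℕ.≟ pairDeg x y (T i')

  steiner? : Dec ((x y : Fin v) (i : Fin μ) → x ≡ y ⊎ pairDeg x y (T i) ≤ 1)
  steiner? = all? λ x → all? λ y → all? λ i → (x Fin.≟ y) ⊎-dec (pairDeg x y (T i) ℕ.≤? 1)

  homogeneous? : Dec ((x : Fin v) (i : Fin μ) → deg x (T i) ≡ d)
  homogeneous? = all? λ x → all? λ i → deg x (T i) ℕ.≟ d

  fromDecisions : True noRepeats? → True disjoint? → True balanced? → True steiner? →
                  True homogeneous? → IsHomogeneousSteinerTrade d T
  fromDecisions nr dj bl st hm = record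
    { noRepeats = λ i j j' j≢j' same → [ j≢j' , (λ ¬same → ¬same same) ] (toWitness nr i j j')
    ; disjoint = λ i i' i≢i' j j' same → [ i≢i' , (λ ¬same → ¬same same) ] (toWitness dj i i' j j')
    ; balanced = toWitness bl
    ; steiner = λ x y x≢y i → [ (λ x≡y → ⊥-elim (x≢y x≡y)) , (λ le → le) ] (toWitness st x y i)
    ; homogeneous = toWitness hm
    }

block : {v : ℕ} (x y z : Fin v) {x<y : True (x <? y)} {y<z : True (y <? z)} → Block v
block x y z {x<y} {y<z} = blk x y z (toWitness x<y) (toWitness y<z)

-- The 9-point trade: with rows {0,1,2}, columns {3,4,5} and symbols {6,7,8},
-- the i-th collection consists of the blocks {r, 3 + c, 6 + s} with
-- s ≡ r + c + i (mod 3); the three Latin squares are pairwise disjoint.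
trade9 : HomogeneousSteinerTrade 3 3 9 9
trade9 = T , Decide.fromDecisions 3 T _ _ _ _ _
  where
  T : Fin 3 → Collection 9 9
  T Fin.zero =
    block (# 0) (# 3) (# 6) ∷ block (# 0) (# 4) (# 7) ∷ block (# 0) (# 5) (# 8) ∷
    block (# 1) (# 3) (# 7) ∷ block (# 1) (# 4) (# 8) ∷ block (# 1) (# 5) (# 6) ∷
    block (# 2) (# 3) (# 8) ∷ block (# 2) (# 4) (# 6) ∷ block (# 2) (# 5) (# 7) ∷ []
  T (Fin.suc Fin.zero) =
    block (# 0) (# 3) (# 7) ∷ block (# 0) (# 4) (# 8) ∷ block (# 0) (# 5) (# 6) ∷
    block (# 1) (# 3) (# 8) ∷ block (# 1) (# 4) (# 6) ∷ block (# 1) (# 5) (# 7) ∷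
    block (# 2) (# 3) (# 6) ∷ block (# 2) (# 4) (# 7) ∷ block (# 2) (# 5) (# 8) ∷ []
  T (Fin.suc (Fin.suc Fin.zero)) =
    block (# 0) (# 3) (# 8) ∷ block (# 0) (# 4) (# 6) ∷ block (# 0) (# 5) (# 7) ∷
    block (# 1) (# 3) (# 6) ∷ block (# 1) (# 4) (# 7) ∷ block (# 1) (# 5) (# 8) ∷
    block (# 2) (# 3) (# 7) ∷ block (# 2) (# 4) (# 8) ∷ block (# 2) (# 5) (# 6) ∷ []

-- The 8-point trade: each collection covers exactly the 24 pairs other than
-- {0,1}, {2,3}, {4,5}, {6,7}, each once, by 8 blocks; the three collections
-- share no block.
trade8 : HomogeneousSteinerTrade 3 3 8 8
trade8 = T , Decide.fromDecisions 3 T _ _ _ _ _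
  where
  T : Fin 3 → Collection 8 8
  T Fin.zero =
    block (# 0) (# 2) (# 4) ∷ block (# 0) (# 3) (# 6) ∷ block (# 0) (# 5) (# 7) ∷
    block (# 1) (# 2) (# 7) ∷ block (# 1) (# 3) (# 5) ∷ block (# 1) (# 4) (# 6) ∷
    block (# 2) (# 5) (# 6) ∷ block (# 3) (# 4) (# 7) ∷ []
  T (Fin.suc Fin.zero) =
    block (# 0) (# 2) (# 5) ∷ block (# 0) (# 3) (# 7) ∷ block (# 0) (# 4) (# 6) ∷
    block (# 1) (# 2) (# 6) ∷ block (# 1) (# 3) (# 4) ∷ block (# 1) (# 5) (# 7) ∷
    block (# 2) (# 4) (# 7) ∷ block (# 3) (# 5) (# 6) ∷ []
  T (Fin.suc (Fin.suc Fin.zero)) =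
    block (# 0) (# 2) (# 6) ∷ block (# 0) (# 3) (# 5) ∷ block (# 0) (# 4) (# 7) ∷
    block (# 1) (# 2) (# 4) ∷ block (# 1) (# 3) (# 7) ∷ block (# 1) (# 5) (# 6) ∷
    block (# 2) (# 5) (# 7) ∷ block (# 3) (# 4) (# 6) ∷ []

theorem2p3 : (l l' : ℕ) → 9 * l + 8 * l' ≢ 0 →
    Σ (Fin 3 → Collection (9 * l + 8 * l') (9 * l + 8 * l')) λ T →
      IsSteinerTrade T × IsHomogeneous 3 T
theorem2p3 l l' _ = proj₁ union , steinerTrade (proj₂ union)
  where
  size : l * 9 + l' * 8 ≡ 9 * l + 8 * l'
  size = cong₂ _+_ (ℕ.*-comm l 9) (ℕ.*-comm l' 8)

  union : HomogeneousSteinerTrade 3 3 (9 * l + 8 * l') (9 * l + 8 * l')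
  union = subst₂ (HomogeneousSteinerTrade 3 3) size size (copies trade9 l ⊕ₜ copies trade8 l')
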